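{- Let $P,Q$ be parts of a system $S$ with $P\ge Q$. Then for constraints $\phi$ on $P$ and $\psi$ on $Q$: $\Diamond^P_Q\phi(q)=\exists p\in B_P.\,(p|_Q=q)\wedge\phi(p)$, i.e. $\Diamond^P_Q=\exists^P_Q$; $\Box^P_Q\phi(q)=\forall p\in B_P.\,(p|_Q=q)\Rightarrow\phi(p)$, i.e. $\Box^P_Q=\forall^P_Q$; $\Diamond^Q_P\psi=\Delta^Q_P\psi=\Box^Q_P\psi$, where $\Delta^Q_P\psi(p)=\psi(p|_Q)$. Conversely, if $P,Q$ are parts of $S$ such that $\Diamond^Q_P\psi\vdash\Box^Q_P\psi$ for every constraint $\psi$ on $Q$, then $P\ge Q$.
   Context: A system $S$ is modeled by a set $B_S$ of possible behaviors. A part $P$ of $S$ is a surjective function $|_P\colon B_S\to B_P$; write $s|_P$ for its value. $P\ge Q$ means there is a function $B_P\to B_Q$, written $p\mapsto p|_Q$, with $(s|_P)|_Q=s|_Q$ for all $s\in B_S$. A constraint on $P$ is a predicate $B_P\to\{\mathtt{true},\mathtt{false}\}$; $\phi\vdash\psi$ is pointwise implication. Allowance: $\Diamond^P_Q\phi(q)=\exists s\in B_S.\,(s|_Q=q)\wedge\phi(s|_P)$. Ensurance: $\Box^P_Q\phi(q)=\forall s\in B_S.\,(s|_Q=q)\Rightarrow\phi(s|_P)$. -}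

module Defs where

open import Data.Product using (Σ; ∃; _×_; _,_)
open import Relation.Binary.PropositionalEquality using (_≡_)
open import Function.Definitions using (Surjective)

-- A system S is given by its type of behaviours B_S.
-- A part P of S: a type of behaviours B_P with a surjection |_P : B_S → B_P.
record Part (BS : Set) : Set₁ where
  field
    B    : Set
    res  : BS → B
    surj : Surjective _≡_ _≡_ res
open Part public

_≥ₚ_ : {BS : Set} → Part BS → Part BS → Set
P ≥ₚ Q = Σ (B P → B Q) λ r → ∀ s → r (res P s) ≡ res Q s

Constraint : {BS : Set} → Part BS → Set₁
Constraint P = B P → Set

_⊢_ : {A : Set} → (A → Set) → (A → Set) → Set
φ ⊢ ψ = ∀ a → φ a → ψ a

_≐_ : {A : Set} → (A → Set) → (A → Set) → Set
φ ≐ ψ = (φ ⊢ ψ) × (ψ ⊢ φ)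

◇ : {BS : Set} (P Q : Part BS) → Constraint P → Constraint Q
◇ {BS} P Q φ q = Σ BS λ s → (res Q s ≡ q) × φ (res P s)

□ : {BS : Set} (P Q : Part BS) → Constraint P → Constraint Q
□ {BS} P Q φ q = (s : BS) → res Q s ≡ q → φ (res P s)

∃ᴾ : {BS : Set} {P Q : Part BS} → P ≥ₚ Q → Constraint P → Constraint Q
∃ᴾ {P = P} (r , _) φ q = Σ (B P) λ p → (r p ≡ q) × φ p

∀ᴾ : {BS : Set} {P Q : Part BS} → P ≥ₚ Q → Constraint P → Constraint Q
∀ᴾ {P = P} (r , _) φ q = (p : B P) → r p ≡ q → φ p

Δ : {BS : Set} {P Q : Part BS} → P ≥ₚ Q → Constraint Q → Constraint P
Δ (r , _) ψ p = ψ (r p)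

-- Throughout, a part P of S comes with a surjective restriction |_P, from
-- which we extract a section  lift : B_P → B_S  (every behaviour of P is
-- the restriction of some behaviour of S).  When P ≥ Q via r : B_P → B_Q,
-- the equation r (s|_P) = s|_Q says that s|_Q is determined by s|_P.
--
-- With these two facts every statement of the theorem is a direct
-- translation: quantifying over system behaviours s with s|_Q = q is the
-- same as quantifying over p ∈ B_P with p|_Q = q (a witness s gives p = s|_P,
-- a witness p gives s = lift p), which yields ◇ = ∃ and □ = ∀; and whenever
-- s|_P = p we have s|_Q = p|_Q, so ◇^Q_P ψ and □^Q_P ψ both collapse to
-- ψ (p|_Q) = Δ ψ p.  For the converse we define p|_Q as (lift p)|_Q and use
-- the hypothesis ◇ ⊢ □ for the constraint "equals s|_Q" to show that any
-- other s' with s'|_P = s|_P has the same Q-restriction.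
module Submission where

open import Defs
open import Data.Product using (_×_; _,_; proj₁; proj₂)
open import Relation.Binary.PropositionalEquality using (_≡_; refl; sym; trans; cong; subst)

module _ {BS : Set} where

  lift : (P : Part BS) → B P → BS
  lift P p = proj₁ (surj P p)

  lift-res : (P : Part BS) (p : B P) → res P (lift P p) ≡ p
  lift-res P p = proj₂ (surj P p) refl

  res-factor : (P Q : Part BS) (h : P ≥ₚ Q) (s : BS) {p : B P} →
               res P s ≡ p → res Q s ≡ proj₁ h p
  res-factor P Q (r , r-res) s e = trans (sym (r-res s)) (cong r e)

  module _ (P Q : Part BS) (h : P ≥ₚ Q) where

    private
      r : B P → B Q
      r = proj₁ h

      lift-factor : (p : B P) → res Q (lift P p) ≡ r p
      lift-factor p = res-factor P Q h (lift P p) (lift-res P p)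

    allowance-is-exists : (φ : Constraint P) → ◇ P Q φ ≐ ∃ᴾ {P = P} {Q = Q} h φ
    allowance-is-exists φ = to , from
      where
      to : ◇ P Q φ ⊢ ∃ᴾ {P = P} {Q = Q} h φ
      to q (s , sQ≡q , φsP) = res P s , trans (proj₂ h s) sQ≡q , φsP

      from : ∃ᴾ {P = P} {Q = Q} h φ ⊢ ◇ P Q φ
      from q (p , pQ≡q , φp) =
        lift P p , trans (lift-factor p) pQ≡q , subst φ (sym (lift-res P p)) φp

    ensurance-is-forall : (φ : Constraint P) → □ P Q φ ≐ ∀ᴾ {P = P} {Q = Q} h φ
    ensurance-is-forall φ = to , from
      where
      to : □ P Q φ ⊢ ∀ᴾ {P = P} {Q = Q} h φ
      to q all-s p pQ≡q =
        subst φ (lift-res P p) (all-s (lift P p) (trans (lift-factor p) pQ≡q))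

      from : ∀ᴾ {P = P} {Q = Q} h φ ⊢ □ P Q φ
      from q all-p s sQ≡q = all-p (res P s) (trans (proj₂ h s) sQ≡q)

    allowance-is-pullback : (ψ : Constraint Q) → ◇ Q P ψ ≐ Δ {P = P} {Q = Q} h ψ
    allowance-is-pullback ψ = to , from
      where
      to : ◇ Q P ψ ⊢ Δ {P = P} {Q = Q} h ψ
      to p (s , sP≡p , ψsQ) = subst ψ (res-factor P Q h s sP≡p) ψsQ

      from : Δ {P = P} {Q = Q} h ψ ⊢ ◇ Q P ψ
      from p ψpQ = lift P p , lift-res P p , subst ψ (sym (lift-factor p)) ψpQ

    pullback-is-ensurance : (ψ : Constraint Q) → Δ {P = P} {Q = Q} h ψ ≐ □ Q P ψ
    pullback-is-ensurance ψ = to , from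
      where
      to : Δ {P = P} {Q = Q} h ψ ⊢ □ Q P ψ
      to p ψpQ s sP≡p = subst ψ (sym (res-factor P Q h s sP≡p)) ψpQ

      from : □ Q P ψ ⊢ Δ {P = P} {Q = Q} h ψ
      from p all-s = subst ψ (lift-factor p) (all-s (lift P p) (lift-res P p))

  -- For a behaviour s, the constraint "= s|_Q" is
  -- allowed at s|_P (witnessed by s), hence ensured there, so it holds of
  -- lift (s|_P) as well.
  ≥-from-allowance-entails-ensurance : (P Q : Part BS) →
    (∀ (ψ : Constraint Q) → ◇ Q P ψ ⊢ □ Q P ψ) → P ≥ₚ Q
  ≥-from-allowance-entails-ensurance P Q ◇⊢□ = r , r-res
    where
    r : B P → B Q
    r p = res Q (lift P p)

    r-res : ∀ s → r (res P s) ≡ res Q s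
    r-res s = ◇⊢□ (λ q → q ≡ res Q s) (res P s) (s , refl , refl)
                  (lift P (res P s)) (lift-res P (res P s))

mainTheorem8 : ({BS : Set} (P Q : Part BS) (h : P ≥ₚ Q) →
    (∀ (φ : Constraint P) → ◇ P Q φ ≐ ∃ᴾ {P = P} {Q = Q} h φ)
    × (∀ (φ : Constraint P) → □ P Q φ ≐ ∀ᴾ {P = P} {Q = Q} h φ)
    × (∀ (ψ : Constraint Q) → (◇ Q P ψ ≐ Δ {P = P} {Q = Q} h ψ) × (Δ {P = P} {Q = Q} h ψ ≐ □ Q P ψ)))
    × ({BS : Set} (P Q : Part BS) →
    (∀ (ψ : Constraint Q) → ◇ Q P ψ ⊢ □ Q P ψ) → P ≥ₚ Q)
mainTheorem8 =
    (λ P Q h →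
        allowance-is-exists P Q h
      , ensurance-is-forall P Q h
      , λ ψ → allowance-is-pullback P Q h ψ , pullback-is-ensurance P Q h ψ)
  , ≥-from-allowance-entails-ensurance
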